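{- Let $\mathcal{C}\subseteq 2^{[n]}$ be an arbitrary family of sets and $g:\mathcal{C}\to\mathbb{Z}$ a function, and let $\mathcal{I} = \{ I\subseteq[n] : |I\cap C|\le g(C)\ \forall C\in\mathcal{C}\}$. For $I\in\mathcal{I}$ let $T(I) = \{C\in\mathcal{C} : |I\cap C| = g(C)\}$. Suppose that for every $I\in\mathcal{I}$ and all $C_1,C_2\in T(I)$, either $C_1\cup C_2\in T(I)$ or $C_1\cap C_2=\emptyset$. Then $\mathcal{I}$ is the family of independent sets of a matroid, if it is non-empty. -}

module Defs where

open import Data.Nat using (ℕ; _<_)
open import Data.Integer using (ℤ; +_; _≤_)
open import Data.Fin using (Fin)
open import Data.Fin.Subset using (Subset; _∩_; _∪_; ∣_∣; ⊥; ⁅_⁆; _∈_; _∉_; _⊆_)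
open import Data.List using (List)
import Data.List.Membership.Propositional as L
open import Data.Product using (∃-syntax; _×_)
open import Relation.Binary.PropositionalEquality using (_≡_)

record IsMatroid {n : ℕ} (ℐ : Subset n → Set) : Set where
  field
    empty-indep : ℐ ⊥
    hereditary  : ∀ {I J : Subset n} → J ⊆ I → ℐ I → ℐ J
    augment     : ∀ {I J : Subset n} → ℐ I → ℐ J → ∣ I ∣ < ∣ J ∣ →
                  ∃[ x ] (x ∈ J × x ∉ I × ℐ (I ∪ ⁅ x ⁆))

Indep : {n : ℕ} → List (Subset n) → (Subset n → ℤ) → Subset n → Set
Indep 𝒞 g I = ∀ C → C L.∈ 𝒞 → + ∣ I ∩ C ∣ ≤ g C

Tight : {n : ℕ} → List (Subset n) → (Subset n → ℤ) → Subset n → Subset n → Set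
Tight 𝒞 g I C = (C L.∈ 𝒞) × (+ ∣ I ∩ C ∣ ≡ g C)

module Submission where

-- Axiom (I2) is immediate, and (I1)
-- follows from (I2) once ℐ is non-empty.  For augmentation (I3) we argue by
-- contradiction: if no x ∈ J ∖ I can be added to I, every such x lies in a
-- tight set of I ("is covered").  Pick such an x.  The uncrossing hypothesis
-- makes the tight sets through x closed under union, so there is a largest
-- one, M.  Because M is tight, |J ∩ M| ≤ |I ∩ M|, hence removing M from both
-- sets keeps |I ∖ M| < |J ∖ M|; by maximality of M every point of J ∖ M not in
-- I is still covered by a tight set of I ∖ M (one disjoint from M).  Since
-- x ∈ J ∩ M, |J| strictly drops, and induction on |J| ends in a contradiction.

open import Defs
open import Data.Nat using (ℕ)
open import Data.Integer using (ℤ)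
open import Data.Fin.Subset using (Subset; _∩_; _∪_; Empty)
open import Data.List using (List)
open import Data.Product using (∃-syntax)
open import Data.Sum using (_⊎_)

open import Data.Nat using (zero; suc; _+_; _≤_; _<_; z≤n)
import Data.Nat.Properties as ℕ
open import Data.Integer using (-[1+_]; +≤+; +<+)
import Data.Integer as ℤ
import Data.Integer.Properties as ℤ
open import Data.Fin using (Fin; zero; suc)
open import Data.Fin.Subset using (_─_; ⁅_⁆; ∣_∣; _∈_; _∉_; _⊆_)
open import Data.Fin.Subset.Properties
  using (_∈?_; ⊆-refl; ⊆-min; ⊆-antisym; p⊆q⇒∣p∣≤∣q∣; ∣⁅x⁆∣≡1; x∈⁅x⁆; x∈⁅y⁆⇒x≡y; x∈p∩q⁺; x∈p∩q⁻; p∩q⊆q;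
         x∈p∪q⁺; x∈p∪q⁻; p⊆p∪q; q⊆p∪q; p─q⊆p; x∈p∧x∉q⇒x∈p─q; p∩q≢∅⇒∣p─q∣<∣p∣)
open import Data.Fin.Properties using (any?)
open import Data.Vec using (_∷_; []; there)
open import Data.Bool using (true; false)
open import Data.List using (_∷_; [])
import Data.List.Relation.Unary.Any as Any
import Data.List.Relation.Unary.All as All
open import Data.List.Relation.Unary.All.Properties using (¬All⇒Any¬)
import Data.List.Membership.Propositional as L
open import Data.Product using (_×_; _,_; proj₁; proj₂)
open import Data.Sum using (inj₁; inj₂)
open import Data.Empty using (⊥-elim)
open import Function using (_∘_)
open import Relation.Nullary using (¬_; Dec; yes; no; contradiction)
open import Relation.Nullary.Decidable using (_×-dec_; ¬?; map′)
open import Relation.Binary.PropositionalEquality using (_≡_; _≢_; refl; sym; trans; cong)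

∣p∣≡∣p─q∣+∣p∩q∣ : ∀ {n} (p q : Subset n) → ∣ p ∣ ≡ ∣ p ─ q ∣ + ∣ p ∩ q ∣
∣p∣≡∣p─q∣+∣p∩q∣ []          []          = refl
∣p∣≡∣p─q∣+∣p∩q∣ (true ∷ p)  (true ∷ q)  = trans (cong suc (∣p∣≡∣p─q∣+∣p∩q∣ p q)) (sym (ℕ.+-suc _ _))
∣p∣≡∣p─q∣+∣p∩q∣ (true ∷ p)  (false ∷ q) = cong suc (∣p∣≡∣p─q∣+∣p∩q∣ p q)
∣p∣≡∣p─q∣+∣p∩q∣ (false ∷ p) (true ∷ q)  = ∣p∣≡∣p─q∣+∣p∩q∣ p q
∣p∣≡∣p─q∣+∣p∩q∣ (false ∷ p) (false ∷ q) = ∣p∣≡∣p─q∣+∣p∩q∣ p q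

x∈p─q⇒x∉q : ∀ {n} (p q : Subset n) {x} → x ∈ p ─ q → x ∉ q
x∈p─q⇒x∉q (_ ∷ p) (true ∷ q)  {zero}  ()
x∈p─q⇒x∉q (_ ∷ p) (false ∷ q) {zero}  _ ()
x∈p─q⇒x∉q (_ ∷ p) (_ ∷ q)     {suc x} (there x∈p─q) (there x∈q) = x∈p─q⇒x∉q p q x∈p─q x∈q

x∈p∪⁅y⁆∩q⇒x∈p∩q : ∀ {n} (p q : Subset n) {x y} → x ∈ (p ∪ ⁅ y ⁆) ∩ q → x ≢ y → x ∈ p ∩ q
x∈p∪⁅y⁆∩q⇒x∈p∩q p q {y = y} x∈ x≢y with x∈p∩q⁻ (p ∪ ⁅ y ⁆) q x∈
... | x∈p∪⁅y⁆ , x∈q with x∈p∪q⁻ p ⁅ y ⁆ x∈p∪⁅y⁆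
...   | inj₁ x∈p   = x∈p∩q⁺ (x∈p , x∈q)
...   | inj₂ x∈⁅y⁆ = contradiction (x∈⁅y⁆⇒x≡y y x∈⁅y⁆) x≢y

∣p∪⁅y⁆∩q∣≤∣p∩q∣ : ∀ {n} (p q : Subset n) {y} → y ∉ q → ∣ (p ∪ ⁅ y ⁆) ∩ q ∣ ≤ ∣ p ∩ q ∣
∣p∪⁅y⁆∩q∣≤∣p∩q∣ p q {y} y∉q = p⊆q⇒∣p∣≤∣q∣ p∪⁅y⁆∩q⊆p∩q
  where
  p∪⁅y⁆∩q⊆p∩q : (p ∪ ⁅ y ⁆) ∩ q ⊆ p ∩ q
  p∪⁅y⁆∩q⊆p∩q x∈ = x∈p∪⁅y⁆∩q⇒x∈p∩q p q x∈ λ { refl → y∉q (proj₂ (x∈p∩q⁻ (p ∪ ⁅ y ⁆) q x∈)) }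

∣p∪⁅y⁆∩q∣≤1+∣p∩q∣ : ∀ {n} (p q : Subset n) y → ∣ (p ∪ ⁅ y ⁆) ∩ q ∣ ≤ suc ∣ p ∩ q ∣
∣p∪⁅y⁆∩q∣≤1+∣p∩q∣ {n} p q y = begin
  ∣ A ∣                          ≡⟨ ∣p∣≡∣p─q∣+∣p∩q∣ A ⁅ y ⁆ ⟩
  ∣ A ─ ⁅ y ⁆ ∣ + ∣ A ∩ ⁅ y ⁆ ∣  ≤⟨ ℕ.+-mono-≤ (p⊆q⇒∣p∣≤∣q∣ A─⁅y⁆⊆p∩q) (p⊆q⇒∣p∣≤∣q∣ (p∩q⊆q A ⁅ y ⁆)) ⟩
  ∣ p ∩ q ∣ + ∣ ⁅ y ⁆ ∣          ≡⟨ cong (∣ p ∩ q ∣ +_) (∣⁅x⁆∣≡1 y) ⟩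
  ∣ p ∩ q ∣ + 1                  ≡⟨ ℕ.+-comm ∣ p ∩ q ∣ 1 ⟩
  suc ∣ p ∩ q ∣                  ∎
  where
  open ℕ.≤-Reasoning
  A : Subset n
  A = (p ∪ ⁅ y ⁆) ∩ q
  A─⁅y⁆⊆p∩q : A ─ ⁅ y ⁆ ⊆ p ∩ q
  A─⁅y⁆⊆p∩q {x} x∈ = x∈p∪⁅y⁆∩q⇒x∈p∩q p q (p─q⊆p A ⁅ y ⁆ x∈)
    λ { refl → x∈p─q⇒x∉q A ⁅ y ⁆ x∈ (x∈⁅x⁆ y) }

p─r∩q≡p∩q : ∀ {n} (p q r : Subset n) → Empty (q ∩ r) → (p ─ r) ∩ q ≡ p ∩ q
p─r∩q≡p∩q p q r q∩r≡∅ = ⊆-antisym shrink grow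
  where
  shrink : (p ─ r) ∩ q ⊆ p ∩ q
  shrink x∈ with x∈p∩q⁻ (p ─ r) q x∈
  ... | x∈p─r , x∈q = x∈p∩q⁺ (p─q⊆p p r x∈p─r , x∈q)
  grow : p ∩ q ⊆ (p ─ r) ∩ q
  grow {x} x∈ with x∈p∩q⁻ p q x∈
  ... | x∈p , x∈q = x∈p∩q⁺ (x∈p∧x∉q⇒x∈p─q x∈p (λ x∈r → q∩r≡∅ (x , x∈p∩q⁺ (x∈q , x∈r))) , x∈q)

∣p∣<∣q∣⇒∃q∖p : ∀ {n} (p q : Subset n) → ∣ p ∣ < ∣ q ∣ → ∃[ x ] (x ∈ q × x ∉ p)
∣p∣<∣q∣⇒∃q∖p p q ∣p∣<∣q∣ with any? (λ x → x ∈? q ×-dec ¬? (x ∈? p))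
... | yes found = found
... | no  none  = contradiction (p⊆q⇒∣p∣≤∣q∣ q⊆p) (ℕ.<⇒≱ ∣p∣<∣q∣)
  where
  q⊆p : q ⊆ p
  q⊆p {x} x∈q with x ∈? p
  ... | yes x∈p = x∈p
  ... | no  x∉p = contradiction (x , x∈q , x∉p) none

squeeze : ∀ b (z : ℤ) → ℤ.+ b ℤ.≤ z → z ℤ.< ℤ.+ suc b → ℤ.+ b ≡ z
squeeze b (ℤ.+ k)    (+≤+ b≤k) (+<+ k<1+b) = cong ℤ.+_ (ℕ.≤-antisym b≤k (ℕ.≤-pred k<1+b))
squeeze b -[1+ k ] ()

module Constraints {n : ℕ} (𝒞 : List (Subset n)) (g : Subset n → ℤ) where

  Covered : Subset n → Fin n → Set
  Covered I y = ∃[ C ] (Tight 𝒞 g I C × y ∈ C)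

  indep? : ∀ I → Dec (Indep 𝒞 g I)
  indep? I = map′ (λ all C → All.lookup all) (λ ind → All.tabulate (ind _))
                  (All.all? (λ C → ℤ.+ ∣ I ∩ C ∣ ℤ.≤? g C) 𝒞)

  violated : ∀ {I} → ¬ Indep 𝒞 g I → ∃[ C ] (C L.∈ 𝒞 × ¬ (ℤ.+ ∣ I ∩ C ∣ ℤ.≤ g C))
  violated {I} dep = L.find (¬All⇒Any¬ (λ C → ℤ.+ ∣ I ∩ C ∣ ℤ.≤? g C) 𝒞
                                       (λ all → dep (λ C → All.lookup all)))

  hereditary : ∀ {I J} → J ⊆ I → Indep 𝒞 g I → Indep 𝒞 g J
  hereditary {I} {J} J⊆I indI C C∈𝒞 = ℤ.≤-trans (+≤+ (p⊆q⇒∣p∣≤∣q∣ J∩C⊆I∩C)) (indI C C∈𝒞)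
    where
    J∩C⊆I∩C : J ∩ C ⊆ I ∩ C
    J∩C⊆I∩C x∈ with x∈p∩q⁻ J C x∈
    ... | x∈J , x∈C = x∈p∩q⁺ (J⊆I x∈J , x∈C)

  -- If y cannot be added to an independent I, then y is covered for I:
  -- the violated constraint must contain y and be tight for I.
  blocked⇒covered : ∀ {I y} → Indep 𝒞 g I → ¬ Indep 𝒞 g (I ∪ ⁅ y ⁆) → Covered I y
  blocked⇒covered {I} {y} indI dep with violated {I ∪ ⁅ y ⁆} dep
  ... | C , C∈𝒞 , I∪y-violates with y ∈? C
  ...   | yes y∈C = C , (C∈𝒞 , squeeze _ (g C) (indI C C∈𝒞) gC<1+∣I∩C∣) , y∈C
    where
    gC<1+∣I∩C∣ : g C ℤ.< ℤ.+ suc ∣ I ∩ C ∣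
    gC<1+∣I∩C∣ = ℤ.<-≤-trans (ℤ.≰⇒> I∪y-violates) (+≤+ (∣p∪⁅y⁆∩q∣≤1+∣p∩q∣ I C y))
  ...   | no  y∉C = contradiction (ℤ.≤-trans (+≤+ (∣p∪⁅y⁆∩q∣≤∣p∩q∣ I C y∉C)) (indI C C∈𝒞)) I∪y-violates

  tight⇒∣J∩M∣≤∣I∩M∣ : ∀ {I J M} → Indep 𝒞 g J → Tight 𝒞 g I M → ∣ J ∩ M ∣ ≤ ∣ I ∩ M ∣
  tight⇒∣J∩M∣≤∣I∩M∣ indJ (M∈𝒞 , tight) =
    ℤ.drop‿+≤+ (ℤ.≤-trans (indJ _ M∈𝒞) (ℤ.≤-reflexive (sym tight)))

  remove-tight-< : ∀ {I J M} → Indep 𝒞 g J → Tight 𝒞 g I M →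
                    ∣ I ∣ < ∣ J ∣ → ∣ I ─ M ∣ < ∣ J ─ M ∣
  remove-tight-< {I} {J} {M} indJ tightM ∣I∣<∣J∣ =
    ℕ.+-cancelʳ-< (∣ I ∩ M ∣) (∣ I ─ M ∣) (∣ J ─ M ∣) (begin-strict
      ∣ I ─ M ∣ + ∣ I ∩ M ∣ ≡⟨ sym (∣p∣≡∣p─q∣+∣p∩q∣ I M) ⟩
      ∣ I ∣                 <⟨ ∣I∣<∣J∣ ⟩
      ∣ J ∣                 ≡⟨ ∣p∣≡∣p─q∣+∣p∩q∣ J M ⟩
      ∣ J ─ M ∣ + ∣ J ∩ M ∣ ≤⟨ ℕ.+-monoʳ-≤ ∣ J ─ M ∣ (tight⇒∣J∩M∣≤∣I∩M∣ {I} {J} indJ tightM) ⟩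
      ∣ J ─ M ∣ + ∣ I ∩ M ∣ ∎)
    where open ℕ.≤-Reasoning

  disjoint-tight : ∀ {I M C} → Tight 𝒞 g I C → Empty (C ∩ M) → Tight 𝒞 g (I ─ M) C
  disjoint-tight {I} {M} {C} (C∈𝒞 , tight) C∩M≡∅ =
    C∈𝒞 , trans (cong ℤ.+_ (cong ∣_∣ (p─r∩q≡p∩q I C M C∩M≡∅))) tight

Uncrossing : ∀ {n} → List (Subset n) → (Subset n → ℤ) → Set
Uncrossing 𝒞 g = ∀ I → Indep 𝒞 g I → ∀ C₁ C₂ → Tight 𝒞 g I C₁ → Tight 𝒞 g I C₂ →
                 Tight 𝒞 g I (C₁ ∪ C₂) ⊎ Empty (C₁ ∩ C₂)

module Augmentation {n : ℕ} (𝒞 : List (Subset n)) (g : Subset n → ℤ)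
                    (uncross : Uncrossing 𝒞 g) where
  open Constraints 𝒞 g

  ∪-tight : ∀ {I A C x} → Indep 𝒞 g I → Tight 𝒞 g I A → Tight 𝒞 g I C →
            x ∈ A → x ∈ C → Tight 𝒞 g I (A ∪ C)
  ∪-tight {I} {A} {C} indI tightA tightC x∈A x∈C with uncross I indI A C tightA tightC
  ... | inj₁ tightA∪C = tightA∪C
  ... | inj₂ A∩C≡∅    = contradiction (_ , x∈p∩q⁺ (x∈A , x∈C)) A∩C≡∅

  record LargestTight (I : Subset n) (x : Fin n) : Set where
    field
      M       : Subset n
      tight   : Tight 𝒞 g I M
      x∈M     : x ∈ M
      largest : ∀ {C} → Tight 𝒞 g I C → x ∈ C → C ⊆ M

  absorb : ∀ {I x} → Indep 𝒞 g I → (l : List (Subset n)) → (∀ {C} → C L.∈ l → C L.∈ 𝒞) →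
           ∀ A → Tight 𝒞 g I A → x ∈ A →
           ∃[ M ] (Tight 𝒞 g I M × A ⊆ M × (∀ {C} → C L.∈ l → Tight 𝒞 g I C → x ∈ C → C ⊆ M))
  absorb indI [] l⊆𝒞 A tightA x∈A = A , tightA , ⊆-refl , λ ()
  absorb {I} {x} indI (C ∷ l) l⊆𝒞 A tightA x∈A with ℤ.+ ∣ I ∩ C ∣ ℤ.≟ g C ×-dec x ∈? C
  ... | yes (eq , x∈C) =
    let tightC = l⊆𝒞 (Any.here refl) , eq
        M , tightM , A∪C⊆M , absorbs = absorb {I} {x} indI l (l⊆𝒞 ∘ Any.there) (A ∪ C)
          (∪-tight {I} indI tightA tightC x∈A x∈C) (x∈p∪q⁺ (inj₁ x∈A))
    in M , tightM , A∪C⊆M ∘ p⊆p∪q C ,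
       λ { (Any.here refl) _ _ → A∪C⊆M ∘ q⊆p∪q A C ; (Any.there C∈l) → absorbs C∈l }
  ... | no ¬tight-through-x =
    let M , tightM , A⊆M , absorbs = absorb {I} {x} indI l (l⊆𝒞 ∘ Any.there) A tightA x∈A
    in M , tightM , A⊆M ,
       λ { (Any.here refl) (_ , eq) x∈C → contradiction (eq , x∈C) ¬tight-through-x
         ; (Any.there C∈l) → absorbs C∈l }

  largestTight : ∀ {I x} → Indep 𝒞 g I → Covered I x → LargestTight I x
  largestTight {I} {x} indI (A , tightA , x∈A) =
    let M , tightM , A⊆M , absorbs = absorb {I} {x} indI 𝒞 (λ C∈𝒞 → C∈𝒞) A tightA x∈A
    in record { M = M ; tight = tightM ; x∈M = A⊆M x∈A
              ; largest = λ tightC → absorbs (proj₁ tightC) tightC }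

  -- Removing the largest tight set M through x keeps every point outside M
  -- covered: a tight set C through y ∉ M cannot uncross with M into a tight
  -- union (that union would lie inside M), so C is disjoint from M.
  covered-outside-largest : ∀ {I x y} → Indep 𝒞 g I → (H : LargestTight I x) → Covered I y →
                            y ∉ LargestTight.M H → Covered (I ─ LargestTight.M H) y
  covered-outside-largest {I} indI record { M = M ; tight = tightM ; x∈M = x∈M ; largest = largest }
                          (C , tightC , y∈C) y∉M with uncross I indI C M tightC tightM
  ... | inj₁ tightC∪M = contradiction (largest tightC∪M (x∈p∪q⁺ (inj₂ x∈M)) (x∈p∪q⁺ (inj₁ y∈C))) y∉M
  ... | inj₂ C∩M≡∅    = C , disjoint-tight {I} tightC C∩M≡∅ , y∈C

  -- Induction on a bound k for |J|: removing the largest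
  -- tight set through a point of J ∖ I preserves all hypotheses and shrinks J.
  not-all-covered : ∀ k {I J} → ∣ J ∣ ≤ k → Indep 𝒞 g I → Indep 𝒞 g J → ∣ I ∣ < ∣ J ∣ →
                    ¬ (∀ {y} → y ∈ J → y ∉ I → Covered I y)
  not-all-covered zero    ∣J∣≤0 _ _ ∣I∣<∣J∣ _ = ℕ.<⇒≱ ∣I∣<∣J∣ (ℕ.≤-trans ∣J∣≤0 z≤n)
  not-all-covered (suc k) {I} {J} ∣J∣≤1+k indI indJ ∣I∣<∣J∣ covered =
    not-all-covered k ∣J─M∣≤k (hereditary (p─q⊆p I M) indI) (hereditary (p─q⊆p J M) indJ)
                    (remove-tight-< {I} {J} indJ tight ∣I∣<∣J∣) covered-in-J─M
    where
    point : ∃[ x ] (x ∈ J × x ∉ I)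
    point = ∣p∣<∣q∣⇒∃q∖p I J ∣I∣<∣J∣

    H : LargestTight I (proj₁ point)
    H = largestTight {I} indI (covered (proj₁ (proj₂ point)) (proj₂ (proj₂ point)))
    open LargestTight H

    ∣J─M∣≤k : ∣ J ─ M ∣ ≤ k
    ∣J─M∣≤k = ℕ.≤-pred (ℕ.≤-trans (p∩q≢∅⇒∣p─q∣<∣p∣ J M (_ , x∈p∩q⁺ (proj₁ (proj₂ point) , x∈M))) ∣J∣≤1+k)

    covered-in-J─M : ∀ {y} → y ∈ J ─ M → y ∉ I ─ M → Covered (I ─ M) y
    covered-in-J─M {y} y∈J─M y∉I─M = covered-outside-largest indI H (covered (p─q⊆p J M y∈J─M) y∉I) y∉M
      where
      y∉M : y ∉ M
      y∉M = x∈p─q⇒x∉q J M y∈J─M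
      y∉I : y ∉ I
      y∉I = λ y∈I → y∉I─M (x∈p∧x∉q⇒x∈p─q y∈I y∉M)

  -- (I3): otherwise every point of J ∖ I would be blocked, hence covered.
  augment : ∀ {I J} → Indep 𝒞 g I → Indep 𝒞 g J → ∣ I ∣ < ∣ J ∣ →
            ∃[ x ] (x ∈ J × x ∉ I × Indep 𝒞 g (I ∪ ⁅ x ⁆))
  augment {I} {J} indI indJ ∣I∣<∣J∣
    with any? (λ x → x ∈? J ×-dec ¬? (x ∈? I) ×-dec indep? (I ∪ ⁅ x ⁆))
  ... | yes addable = addable
  ... | no  none    = ⊥-elim (not-all-covered ∣ J ∣ ℕ.≤-refl indI indJ ∣I∣<∣J∣ λ y∈J y∉I →
                        blocked⇒covered {I} indI λ indI∪y → none (_ , y∈J , y∉I , indI∪y))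

mainTheorem16 : (n : ℕ) (𝒞 : List (Subset n)) (g : Subset n → ℤ) →
    (∀ I → Indep 𝒞 g I → ∀ C₁ C₂ → Tight 𝒞 g I C₁ → Tight 𝒞 g I C₂ →
       Tight 𝒞 g I (C₁ ∪ C₂) ⊎ Empty (C₁ ∩ C₂)) →
    ∃[ I ] Indep 𝒞 g I →
    IsMatroid (Indep 𝒞 g)
mainTheorem16 n 𝒞 g uncross (I₀ , indI₀) = record
  { empty-indep = hereditary (⊆-min I₀) indI₀
  ; hereditary  = hereditary
  ; augment     = augment
  }
  where
  open Constraints 𝒞 g
  open Augmentation 𝒞 g uncross
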